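{- The extended shuffle product $\sqcup\!\sqcup$ on $\mathcal H_{\mathbb Z}$ is associative: $(a\sqcup\!\sqcup b)\sqcup\!\sqcup c=a\sqcup\!\sqcup(b\sqcup\!\sqcup c)$ for all $a,b,c\in\mathcal H_{\mathbb Z}$.
   Context: Let $\mathcal H_{\mathbb Z}$ be the $\mathbb Q$-vector space with basis $\mathbf 1$ together with the formal symbols $[s_1,\dots,s_k]$ for $k\ge1$ and $(s_1,\dots,s_k)\in\mathbb Z^k$. Define linear maps on basis elements of positive depth by $I([s_1,s_2,\dots,s_k])=[s_1+1,s_2,\dots,s_k]$ and $J([s_1,s_2,\dots,s_k])=[s_1-1,s_2,\dots,s_k]$, and set $J(\mathbf 1)=0$. Notation: for a positive-depth basis element, write $[s_1,\dots,s_k]=[s_1,\vec s\,']$, where $[\vec s\,']=[s_2,\dots,s_k]$, or $\mathbf 1$ if $k=1$. For $a\in\mathbb Z$ and $X=\sum c_{\vec v}[\vec v]$, put $[a,X]:=\sum c_{\vec v}[a,\vec v]$, with $[a,\mathbf 1]:=[a]$. The extended shuffle product $\sqcup\!\sqcup$ is the bilinear product with two-sided unit $\mathbf 1$, defined on positive-depth basis elements by the following recursions: <ul> <li>(i) if $s_1=0$: $[0,\vec s\,']\sqcup\!\sqcup[t_1,\vec t\,']=[0,[\vec s\,']\sqcup\!\sqcup[t_1,\vec t\,']]$;</li> <li>(ii) if $s_1>0$ and $t_1=0$: $[s_1,\vec s\,']\sqcup\!\sqcup[0,\vec t\,']=[0,[s_1,\vec s\,']\sqcup\!\sqcup[\vec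 t\,']]$;</li> <li>(iii) if $s_1,t_1>0$: $[s_1,\vec s\,']\sqcup\!\sqcup[t_1,\vec t\,']=I([s_1,\vec s\,']\sqcup\!\sqcup[t_1-1,\vec t\,'])+I([s_1-1,\vec s\,']\sqcup\!\sqcup[t_1,\vec t\,'])$;</li> <li>(iv) if $s_1>0$ and $t_1<0$: $[s_1,\vec s\,']\sqcup\!\sqcup[t_1,\vec t\,']=J([s_1,\vec s\,']\sqcup\!\sqcup[t_1+1,\vec t\,'])-[s_1-1,\vec s\,']\sqcup\!\sqcup[t_1+1,\vec t\,']$;</li> <li>(v) if $s_1<0$: $[s_1,\vec s\,']\sqcup\!\sqcup[t_1,\vec t\,']=J([s_1+1,\vec s\,']\sqcup\!\sqcup[t_1,\vec t\,'])-[s_1+1,\vec s\,']\sqcup\!\sqcup[t_1-1,\vec t\,']$.</li> </ul> The recursions are well founded: (i) and (ii) by induction on total depth, (iii) on $s_1+t_1$, (iv) on $|t_1|$, and (v) on $|s_1|$. -}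

module Defs where

open import Data.Nat using (ℕ; zero; suc)
open import Data.Integer as ℤ using (ℤ; +_; -[1+_])
open import Data.Rational as ℚ using (ℚ; 0ℚ; 1ℚ)
open import Data.List using (List; []; _∷_; _++_; map; concatMap)
open import Data.List.Properties using (≡-dec)
open import Data.Product using (_×_; _,_)
open import Relation.Nullary using (yes; no)

-- A word (s₁,…,s_k) ∈ ℤ^k; the empty word [] stands for the basis element 𝟏.
Word : Set
Word = List ℤ

-- Elements of H_ℤ: finite formal ℚ-linear combinations of words.
-- Two such lists denote the same vector iff all their coefficients agree (see coeff).
H : Set
H = List (ℚ × Word)

coeff : H → Word → ℚ
coeff [] w = 0ℚ
coeff ((c , v) ∷ x) w with ≡-dec ℤ._≟_ v w
... | yes _ = c ℚ.+ coeff x w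
... | no  _ = coeff x w

⟦_⟧ : Word → H
⟦ w ⟧ = (1ℚ , w) ∷ []

zeroH : H
zeroH = []

_⊕_ : H → H → H
x ⊕ y = x ++ y

scale : ℚ → H → H
scale c = map (λ { (d , w) → (c ℚ.* d , w) })

_⊖_ : H → H → H
x ⊖ y = x ++ scale (ℚ.- 1ℚ) y

prefix : ℤ → H → H
prefix a = map (λ { (d , w) → (d , a ∷ w) })

-- I and J on basis elements; J(𝟏) = 0.  I(𝟏) is never used by the
-- recursions (they only apply I to products of positive-depth words); we set it to 0.
I : H → H
I [] = []
I ((d , []) ∷ x) = I x
I ((d , s ∷ w) ∷ x) = (d , ℤ.suc s ∷ w) ∷ I x

J : H → H
J [] = []
J ((d , []) ∷ x) = J x
J ((d , s ∷ w) ∷ x) = (d , ℤ.pred s ∷ w) ∷ J x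

-- Head recursion for [x , s'] ⧢ [y , t'] with tails s', t' fixed.
-- g u  = [s'] ⧢ [u]          (u arbitrary word)
-- h x' = [x' , s'] ⧢ [t']
module Heads (t' : Word) (g : Word → H) (h : ℤ → H) where

  Z : ℤ → H          -- [0 , s'] ⧢ [y , t']          (rule (i))
  Z y = prefix (+ 0) (g (y ∷ t'))

  P : ℕ → ℕ → H
  P zero b = Z (+ b)
  P (suc m) zero = prefix (+ 0) (h (+ suc m))
  P (suc m) (suc n) = I (P (suc m) n) ⊕ I (P m (suc n))

  Q : ℕ → ℕ → H
  Q zero n = Z -[1+ n ]
  Q (suc m) zero = J (P (suc m) zero) ⊖ P m zero                  -- rule (iv), y+1 = 0
  Q (suc m) (suc n) = J (Q (suc m) n) ⊖ Q m n

  Neg : ℕ → ℤ → H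
  Neg zero y = J (Z y) ⊖ Z (ℤ.pred y)
  Neg (suc m) y = J (Neg m y) ⊖ Neg m (ℤ.pred y)

  heads : ℤ → ℤ → H
  heads (+ a) (+ b) = P a b
  heads (+ a) -[1+ n ] = Q a n
  heads -[1+ m ] y = Neg m y

mutual
  shw : Word → Word → H
  shw [] t = ⟦ t ⟧
  shw (x ∷ s') t = shc x s' (shw s') t

  -- shc x s' g t = [x , s'] ⧢ [t], where g = ([s'] ⧢ _)
  shc : ℤ → Word → (Word → H) → Word → H
  shc x s' g [] = ⟦ x ∷ s' ⟧
  shc x s' g (y ∷ t') = Heads.heads t' g (λ x' → shc x' s' g t') x y

_⧢_ : H → H → H
a ⧢ b = concatMap (λ { (c , v) → concatMap (λ { (d , w) → scale (c ℚ.* d) (shw v w) }) b }) a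

infixl 7 _⧢_

{-# OPTIONS --safe #-}
-- Vectors are compared through their pairings ⟨ F ∣ x ⟩ with all functionals F : Word → ℚ, so
-- I, J and ⧢ are studied through their transposes.  J is a derivation of ⧢: on words this is
-- rule (iii), I being inverse to J, and rules (iv), (v) solved for their J-term.  Fix tails a, b, c
-- and let A(s,t,u) be the associator of the words s∷a, t∷b, u∷c.  The Leibniz rule gives
--   J A(s,t,u) = A(s−1,t,u) + A(s,t−1,u) + A(s,t,u−1),
-- and since I inverts J on vectors not involving 𝟏, if three of these four terms vanish so does
-- the fourth.  Rules (i) and (ii), with induction on the tails, make A vanish on the faces s = 0,
-- t = 0 < s and u = 0 < s, t, and from these faces the relation reaches all of ℤ³.  Bilinearity
-- extends associativity from words to H_ℤ.
module Submission where

open import Defs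
open import Data.Rational using (ℚ)
open import Relation.Binary.PropositionalEquality using (_≡_)

open import Data.Empty using (⊥)
open import Data.Unit using (⊤)
open import Data.Nat using (zero; suc)
import Data.Integer as ℤ
open ℤ using (ℤ; +_; -[1+_]; +[1+_])
import Data.Integer.Properties as ℤₚ
open import Data.Rational using (0ℚ; 1ℚ; _+_; _*_; _-_; -_)
import Data.Rational.Properties as ℚₚ
open import Data.Rational.Solver using (module +-*-Solver)
open +-*-Solver using (solve; _:+_; _:*_; _:-_; :-_; _:=_; con)
open import Algebra.Properties.Group ℚₚ.+-0-group using (∙-cancelˡ; ∙-cancelʳ)
open import Data.List using ([]; _∷_; concatMap)
open import Data.List.Properties using (≡-dec; ++-assoc)
import Data.List.Relation.Unary.All as All
open All using (All; []; _∷_)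
open import Data.List.Relation.Unary.All.Properties using (++⁺; map⁺; concat⁺)
open import Data.Product using (_×_; _,_; proj₂)
open import Function using (_∘_)
open import Relation.Binary.Bundles using (Setoid)
import Relation.Binary.Reasoning.Setoid as SetoidReasoning
open import Relation.Binary.PropositionalEquality
  using (refl; sym; trans; cong; cong₂; module ≡-Reasoning)
open import Relation.Nullary using (yes; no)

-- Induction over ℤ³ from three coordinate faces

module _ {ℓ} (P : ℤ → ℤ → ℤ → Set ℓ)
  (face₁ : ∀ t u → P (+ 0) t u)
  (face₂ : ∀ m u → P +[1+ m ] (+ 0) u)
  (face₃ : ∀ m n → P +[1+ m ] +[1+ n ] (+ 0))
  (raise : ∀ s t u → P (ℤ.pred s) t u → P s (ℤ.pred t) u → P s t (ℤ.pred u) → P s t u)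
  (lower₁ : ∀ s t u → P s t u → P s (ℤ.pred t) u → P s t (ℤ.pred u) → P (ℤ.pred s) t u)
  (lower₂ : ∀ s t u → P s t u → P (ℤ.pred s) t u → P s t (ℤ.pred u) → P s (ℤ.pred t) u)
  (lower₃ : ∀ s t u → P s t u → P (ℤ.pred s) t u → P s (ℤ.pred t) u → P s t (ℤ.pred u))
  where

  private
    negative : ∀ k t u → P -[1+ k ] t u
    negative zero t u = lower₁ (+ 0) t u (face₁ t u) (face₁ (ℤ.pred t) u) (face₁ t (ℤ.pred u))
    negative (suc k) t u =
      lower₁ -[1+ k ] t u (negative k t u) (negative k (ℤ.pred t) u) (negative k t (ℤ.pred u))

    line : ∀ m n → (∀ t u → P (+ m) t u) → (∀ u → P +[1+ m ] (+ n) u) →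
           ∀ u → P +[1+ m ] +[1+ n ] u
    line m n below left (+ j) = up j
      where
      up : ∀ j → P +[1+ m ] +[1+ n ] (+ j)
      up zero = face₃ m n
      up (suc j) = raise +[1+ m ] +[1+ n ] +[1+ j ] (below +[1+ n ] +[1+ j ]) (left +[1+ j ]) (up j)
    line m n below left -[1+ k ] = down k
      where
      down : ∀ k → P +[1+ m ] +[1+ n ] -[1+ k ]
      down zero = lower₃ +[1+ m ] +[1+ n ] (+ 0) (face₃ m n) (below +[1+ n ] (+ 0)) (left (+ 0))
      down (suc k) =
        lower₃ +[1+ m ] +[1+ n ] -[1+ k ] (down k) (below +[1+ n ] -[1+ k ]) (left -[1+ k ])

    layer : ∀ m → (∀ t u → P (+ m) t u) → ∀ t u → P +[1+ m ] t u
    layer m below (+ n) = up n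
      where
      up : ∀ n u → P +[1+ m ] (+ n) u
      up zero = face₂ m
      up (suc n) = line m n below (up n)
    layer m below -[1+ k ] = down k
      where
      down : ∀ k u → P +[1+ m ] -[1+ k ] u
      down zero u = lower₂ +[1+ m ] (+ 0) u (face₂ m u) (below (+ 0) u) (face₂ m (ℤ.pred u))
      down (suc k) u = lower₂ +[1+ m ] -[1+ k ] u (down k u) (below -[1+ k ] u) (down k (ℤ.pred u))

    nonNegative : ∀ m t u → P (+ m) t u
    nonNegative zero = face₁
    nonNegative (suc m) = layer m (nonNegative m)

  cube-induction : ∀ s t u → P s t u
  cube-induction (+ m) = nonNegative m
  cube-induction -[1+ k ] = negative k

-- Pairing with functionals

H* : Set
H* = Word → ℚ

⟨_∣_⟩ : H* → H → ℚ
⟨ F ∣ [] ⟩ = 0ℚ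
⟨ F ∣ (c , w) ∷ x ⟩ = c * F w + ⟨ F ∣ x ⟩

⟨∣⊕⟩ : ∀ F x y → ⟨ F ∣ x ⊕ y ⟩ ≡ ⟨ F ∣ x ⟩ + ⟨ F ∣ y ⟩
⟨∣⊕⟩ F [] y = sym (ℚₚ.+-identityˡ _)
⟨∣⊕⟩ F ((c , w) ∷ x) y =
  trans (cong (_+_ (c * F w)) (⟨∣⊕⟩ F x y)) (sym (ℚₚ.+-assoc (c * F w) ⟨ F ∣ x ⟩ ⟨ F ∣ y ⟩))

⟨∣scale⟩ : ∀ F c x → ⟨ F ∣ scale c x ⟩ ≡ c * ⟨ F ∣ x ⟩
⟨∣scale⟩ F c [] = sym (ℚₚ.*-zeroʳ c)
⟨∣scale⟩ F c ((d , w) ∷ x) =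
  trans (cong₂ _+_ (ℚₚ.*-assoc c d (F w)) (⟨∣scale⟩ F c x)) (sym (ℚₚ.*-distribˡ-+ c _ _))

⟨∣⊖⟩ : ∀ F x y → ⟨ F ∣ x ⊖ y ⟩ ≡ ⟨ F ∣ x ⟩ - ⟨ F ∣ y ⟩
⟨∣⊖⟩ F x y = trans (⟨∣⊕⟩ F x (scale (- 1ℚ) y))
  (cong (_+_ ⟨ F ∣ x ⟩) (trans (⟨∣scale⟩ F (- 1ℚ) y) (minus-one ⟨ F ∣ y ⟩)))
  where
  minus-one : ∀ p → - 1ℚ * p ≡ - p
  minus-one = solve 1 (λ p → :- con 1ℚ :* p := :- p) refl

⟨∣⟦⟧⟩ : ∀ F w → ⟨ F ∣ ⟦ w ⟧ ⟩ ≡ F w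
⟨∣⟦⟧⟩ F w = trans (ℚₚ.+-identityʳ _) (ℚₚ.*-identityˡ _)

⟨∣prefix⟩ : ∀ F a x → ⟨ F ∣ prefix a x ⟩ ≡ ⟨ F ∘ (a ∷_) ∣ x ⟩
⟨∣prefix⟩ F a [] = refl
⟨∣prefix⟩ F a ((d , w) ∷ x) = cong (_+_ (d * F (a ∷ w))) (⟨∣prefix⟩ F a x)

⟨∣⟩-cong : ∀ {F G} → (∀ w → F w ≡ G w) → ∀ x → ⟨ F ∣ x ⟩ ≡ ⟨ G ∣ x ⟩
⟨∣⟩-cong eq [] = refl
⟨∣⟩-cong eq ((c , w) ∷ x) = cong₂ (λ a b → c * a + b) (eq w) (⟨∣⟩-cong eq x)

⟨+∣⟩ : ∀ F G x → ⟨ (λ w → F w + G w) ∣ x ⟩ ≡ ⟨ F ∣ x ⟩ + ⟨ G ∣ x ⟩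
⟨+∣⟩ F G [] = sym (ℚₚ.+-identityˡ 0ℚ)
⟨+∣⟩ F G ((c , w) ∷ x) = trans (cong (_+_ (c * (F w + G w))) (⟨+∣⟩ F G x))
  (solve 5 (λ c f g a b → c :* (f :+ g) :+ (a :+ b) := c :* f :+ a :+ (c :* g :+ b))
         refl c (F w) (G w) ⟨ F ∣ x ⟩ ⟨ G ∣ x ⟩)

⟨*∣⟩ : ∀ k F x → ⟨ (λ w → k * F w) ∣ x ⟩ ≡ k * ⟨ F ∣ x ⟩
⟨*∣⟩ k F [] = sym (ℚₚ.*-zeroʳ k)
⟨*∣⟩ k F ((c , w) ∷ x) = trans (cong (_+_ (c * (k * F w))) (⟨*∣⟩ k F x))
  (solve 4 (λ c k f a → c :* (k :* f) :+ k :* a := k :* (c :* f :+ a)) refl c k (F w) ⟨ F ∣ x ⟩)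

⟨0∣⟩ : ∀ x → ⟨ (λ _ → 0ℚ) ∣ x ⟩ ≡ 0ℚ
⟨0∣⟩ [] = refl
⟨0∣⟩ ((c , w) ∷ x) = trans (cong (_+_ (c * 0ℚ)) (⟨0∣⟩ x)) (trans (ℚₚ.+-identityʳ _) (ℚₚ.*-zeroʳ c))

⟨∣⟩-swap : ∀ (G : Word → Word → ℚ) x y →
           ⟨ (λ v → ⟨ G v ∣ y ⟩) ∣ x ⟩ ≡ ⟨ (λ w → ⟨ (λ v → G v w) ∣ x ⟩) ∣ y ⟩
⟨∣⟩-swap G [] y = sym (⟨0∣⟩ y)
⟨∣⟩-swap G ((c , v) ∷ x) y = begin
    c * ⟨ G v ∣ y ⟩ + ⟨ (λ v → ⟨ G v ∣ y ⟩) ∣ x ⟩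
  ≡⟨ cong₂ _+_ (sym (⟨*∣⟩ c (G v) y)) (⟨∣⟩-swap G x y) ⟩
    ⟨ (λ w → c * G v w) ∣ y ⟩ + ⟨ (λ w → ⟨ (λ v → G v w) ∣ x ⟩) ∣ y ⟩
  ≡⟨ sym (⟨+∣⟩ _ _ y) ⟩
    ⟨ (λ w → c * G v w + ⟨ (λ v → G v w) ∣ x ⟩) ∣ y ⟩
  ∎
  where open ≡-Reasoning

⟨∣concatMap⟩ : ∀ F (G : H*) (f : ℚ × Word → H) → (∀ c w → ⟨ F ∣ f (c , w) ⟩ ≡ c * G w) →
               ∀ x → ⟨ F ∣ concatMap f x ⟩ ≡ ⟨ G ∣ x ⟩
⟨∣concatMap⟩ F G f eq [] = refl
⟨∣concatMap⟩ F G f eq ((c , w) ∷ x) =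
  trans (⟨∣⊕⟩ F (f (c , w)) _) (cong₂ _+_ (eq c w) (⟨∣concatMap⟩ F G f eq x))

Iᵀ Jᵀ : H* → H*
Iᵀ F [] = 0ℚ
Iᵀ F (s ∷ w) = F (ℤ.suc s ∷ w)
Jᵀ F [] = 0ℚ
Jᵀ F (s ∷ w) = F (ℤ.pred s ∷ w)

private
  drop-zero-term : ∀ d e → d * 0ℚ + e ≡ e
  drop-zero-term d e = trans (cong (_+ e) (ℚₚ.*-zeroʳ d)) (ℚₚ.+-identityˡ e)

⟨∣I⟩ : ∀ F x → ⟨ F ∣ I x ⟩ ≡ ⟨ Iᵀ F ∣ x ⟩
⟨∣I⟩ F [] = refl
⟨∣I⟩ F ((d , []) ∷ x) = trans (⟨∣I⟩ F x) (sym (drop-zero-term d _))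
⟨∣I⟩ F ((d , s ∷ w) ∷ x) = cong (_+_ (d * F (ℤ.suc s ∷ w))) (⟨∣I⟩ F x)

⟨∣J⟩ : ∀ F x → ⟨ F ∣ J x ⟩ ≡ ⟨ Jᵀ F ∣ x ⟩
⟨∣J⟩ F [] = refl
⟨∣J⟩ F ((d , []) ∷ x) = trans (⟨∣J⟩ F x) (sym (drop-zero-term d _))
⟨∣J⟩ F ((d , s ∷ w) ∷ x) = cong (_+_ (d * F (ℤ.pred s ∷ w))) (⟨∣J⟩ F x)

Δ : H* → Word → H*
Δ F v u = ⟨ F ∣ shw v u ⟩

⟨∣⧢⟩ : ∀ F x y → ⟨ F ∣ x ⧢ y ⟩ ≡ ⟨ (λ v → ⟨ Δ F v ∣ y ⟩) ∣ x ⟩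
⟨∣⧢⟩ F x y = ⟨∣concatMap⟩ F _ _ row x
  where
  row : ∀ c v →
        ⟨ F ∣ concatMap (λ { (d , w) → scale (c * d) (shw v w) }) y ⟩ ≡ c * ⟨ Δ F v ∣ y ⟩
  row c v = trans (⟨∣concatMap⟩ F (λ w → c * Δ F v w) _ entry y) (⟨*∣⟩ c (Δ F v) y)
    where
    entry : ∀ d w → ⟨ F ∣ scale (c * d) (shw v w) ⟩ ≡ d * (c * Δ F v w)
    entry d w = trans (⟨∣scale⟩ F (c * d) (shw v w))
      (solve 3 (λ c d e → (c :* d) :* e := d :* (c :* e)) refl c d (Δ F v w))

infix 4 _≈_
record _≈_ (x y : H) : Set where
  constructor mk≈
  field test : ∀ F → ⟨ F ∣ x ⟩ ≡ ⟨ F ∣ y ⟩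
open _≈_

≈-refl : ∀ {x} → x ≈ x
≈-refl = mk≈ λ _ → refl

≈-sym : ∀ {x y} → x ≈ y → y ≈ x
≈-sym p = mk≈ λ F → sym (test p F)

≈-trans : ∀ {x y z} → x ≈ y → y ≈ z → x ≈ z
≈-trans p q = mk≈ λ F → trans (test p F) (test q F)

≈-setoid : Setoid _ _
≈-setoid = record
  { Carrier = H ; _≈_ = _≈_
  ; isEquivalence = record { refl = ≈-refl ; sym = ≈-sym ; trans = ≈-trans } }

module ≈-Reasoning = SetoidReasoning ≈-setoid

⊕-cong : ∀ {x x′ y y′} → x ≈ x′ → y ≈ y′ → x ⊕ y ≈ x′ ⊕ y′
⊕-cong {x} {x′} {y} {y′} p q = mk≈ λ F →
  trans (⟨∣⊕⟩ F x y) (trans (cong₂ _+_ (test p F) (test q F)) (sym (⟨∣⊕⟩ F x′ y′)))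

⊕-congˡ : ∀ x {y y′} → y ≈ y′ → x ⊕ y ≈ x ⊕ y′
⊕-congˡ x = ⊕-cong (≈-refl {x})

⊕-congʳ : ∀ y {x x′} → x ≈ x′ → x ⊕ y ≈ x′ ⊕ y
⊕-congʳ y p = ⊕-cong p (≈-refl {y})

⊕-assoc : ∀ x y z → (x ⊕ y) ⊕ z ≈ x ⊕ (y ⊕ z)
⊕-assoc x y z = mk≈ λ F → cong ⟨ F ∣_⟩ (++-assoc x y z)

⊕-cancelˡ : ∀ {x y z z′} → z ⊕ x ≈ z′ ⊕ y → z ≈ z′ → x ≈ y
⊕-cancelˡ {x} {y} {z} {z′} p q = mk≈ λ F → ∙-cancelˡ ⟨ F ∣ z ⟩ _ _ (begin
    ⟨ F ∣ z ⟩ + ⟨ F ∣ x ⟩   ≡⟨ sym (⟨∣⊕⟩ F z x) ⟩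
    ⟨ F ∣ z ⊕ x ⟩           ≡⟨ test p F ⟩
    ⟨ F ∣ z′ ⊕ y ⟩          ≡⟨ ⟨∣⊕⟩ F z′ y ⟩
    ⟨ F ∣ z′ ⟩ + ⟨ F ∣ y ⟩  ≡⟨ cong (_+ ⟨ F ∣ y ⟩) (sym (test q F)) ⟩
    ⟨ F ∣ z ⟩ + ⟨ F ∣ y ⟩   ∎)
  where open ≡-Reasoning

⊕-cancelʳ : ∀ {x y z z′} → x ⊕ z ≈ y ⊕ z′ → z ≈ z′ → x ≈ y
⊕-cancelʳ {x} {y} {z} {z′} p q = mk≈ λ F → ∙-cancelʳ ⟨ F ∣ z ⟩ _ _ (begin
    ⟨ F ∣ x ⟩ + ⟨ F ∣ z ⟩   ≡⟨ sym (⟨∣⊕⟩ F x z) ⟩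
    ⟨ F ∣ x ⊕ z ⟩           ≡⟨ test p F ⟩
    ⟨ F ∣ y ⊕ z′ ⟩          ≡⟨ ⟨∣⊕⟩ F y z′ ⟩
    ⟨ F ∣ y ⟩ + ⟨ F ∣ z′ ⟩  ≡⟨ cong (_+_ ⟨ F ∣ y ⟩) (sym (test q F)) ⟩
    ⟨ F ∣ y ⟩ + ⟨ F ∣ z ⟩   ∎)
  where open ≡-Reasoning

I-cong : ∀ {x y} → x ≈ y → I x ≈ I y
I-cong {x} {y} p = mk≈ λ F → trans (⟨∣I⟩ F x) (trans (test p (Iᵀ F)) (sym (⟨∣I⟩ F y)))

J-cong : ∀ {x y} → x ≈ y → J x ≈ J y
J-cong {x} {y} p = mk≈ λ F → trans (⟨∣J⟩ F x) (trans (test p (Jᵀ F)) (sym (⟨∣J⟩ F y)))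

prefix-cong : ∀ a {x y} → x ≈ y → prefix a x ≈ prefix a y
prefix-cong a {x} {y} p = mk≈ λ F →
  trans (⟨∣prefix⟩ F a x) (trans (test p _) (sym (⟨∣prefix⟩ F a y)))

⧢-congʳ : ∀ z {x x′} → x ≈ x′ → x ⧢ z ≈ x′ ⧢ z
⧢-congʳ z {x} {x′} p = mk≈ λ F →
  trans (⟨∣⧢⟩ F x z) (trans (test p _) (sym (⟨∣⧢⟩ F x′ z)))

⧢-congˡ : ∀ x {y y′} → y ≈ y′ → x ⧢ y ≈ x ⧢ y′
⧢-congˡ x {y} {y′} p = mk≈ λ F →
  trans (⟨∣⧢⟩ F x y) (trans (⟨∣⟩-cong (λ v → test p (Δ F v)) x) (sym (⟨∣⧢⟩ F x y′)))

⧢-distribʳ-⊕ : ∀ x y z → (x ⊕ y) ⧢ z ≈ (x ⧢ z) ⊕ (y ⧢ z)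
⧢-distribʳ-⊕ x y z = mk≈ λ F → let G = λ v → ⟨ Δ F v ∣ z ⟩ in begin
    ⟨ F ∣ (x ⊕ y) ⧢ z ⟩                  ≡⟨ ⟨∣⧢⟩ F (x ⊕ y) z ⟩
    ⟨ G ∣ x ⊕ y ⟩                        ≡⟨ ⟨∣⊕⟩ G x y ⟩
    ⟨ G ∣ x ⟩ + ⟨ G ∣ y ⟩                ≡⟨ sym (cong₂ _+_ (⟨∣⧢⟩ F x z) (⟨∣⧢⟩ F y z)) ⟩
    ⟨ F ∣ x ⧢ z ⟩ + ⟨ F ∣ y ⧢ z ⟩        ≡⟨ sym (⟨∣⊕⟩ F (x ⧢ z) (y ⧢ z)) ⟩
    ⟨ F ∣ (x ⧢ z) ⊕ (y ⧢ z) ⟩            ∎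
  where open ≡-Reasoning

⧢-distribˡ-⊕ : ∀ x y z → x ⧢ (y ⊕ z) ≈ (x ⧢ y) ⊕ (x ⧢ z)
⧢-distribˡ-⊕ x y z = mk≈ λ F → begin
    ⟨ F ∣ x ⧢ (y ⊕ z) ⟩
  ≡⟨ ⟨∣⧢⟩ F x (y ⊕ z) ⟩
    ⟨ (λ v → ⟨ Δ F v ∣ y ⊕ z ⟩) ∣ x ⟩
  ≡⟨ trans (⟨∣⟩-cong (λ v → ⟨∣⊕⟩ (Δ F v) y z) x) (⟨+∣⟩ _ _ x) ⟩
    ⟨ (λ v → ⟨ Δ F v ∣ y ⟩) ∣ x ⟩ + ⟨ (λ v → ⟨ Δ F v ∣ z ⟩) ∣ x ⟩
  ≡⟨ sym (cong₂ _+_ (⟨∣⧢⟩ F x y) (⟨∣⧢⟩ F x z)) ⟩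
    ⟨ F ∣ x ⧢ y ⟩ + ⟨ F ∣ x ⧢ z ⟩
  ≡⟨ sym (⟨∣⊕⟩ F (x ⧢ y) (x ⧢ z)) ⟩
    ⟨ F ∣ (x ⧢ y) ⊕ (x ⧢ z) ⟩
  ∎
  where open ≡-Reasoning

-- Shapes of the words occurring in a vector

AllWords : (Word → Set) → H → Set
AllWords P = All (P ∘ proj₂)

Head : (ℤ → Set) → Word → Set
Head P [] = ⊥
Head P (s ∷ _) = P s

NonEmpty : Word → Set
NonEmpty = Head (λ _ → ⊤)

⟨∣⟩-congOn : ∀ {P F G} → (∀ w → P w → F w ≡ G w) →
             ∀ x → AllWords P x → ⟨ F ∣ x ⟩ ≡ ⟨ G ∣ x ⟩
⟨∣⟩-congOn eq [] [] = refl
⟨∣⟩-congOn eq ((c , w) ∷ x) (p ∷ ps) = cong₂ (λ a b → c * a + b) (eq w p) (⟨∣⟩-congOn eq x ps)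

AllWords-scale : ∀ {P} c x → AllWords P x → AllWords P (scale c x)
AllWords-scale c x ps = map⁺ ps

AllWords-⊖ : ∀ {P} x y → AllWords P x → AllWords P y → AllWords P (x ⊖ y)
AllWords-⊖ x y px py = ++⁺ px (AllWords-scale (- 1ℚ) y py)

AllWords-prefix : ∀ {P} a x → (∀ w → P (a ∷ w)) → AllWords P (prefix a x)
AllWords-prefix a x p = map⁺ (All.universal (p ∘ proj₂) x)

AllWords-⧢ : ∀ {P Q R} → (∀ v w → P v → Q w → AllWords R (shw v w)) →
             ∀ x y → AllWords P x → AllWords Q y → AllWords R (x ⧢ y)
AllWords-⧢ shw-R x y px qy =
  concat⁺ (map⁺ (All.map (λ {(_ , v)} p →
    concat⁺ (map⁺ (All.map (λ {(_ , w)} q → map⁺ (shw-R v w p q)) qy))) px))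

I-nonEmpty : ∀ x → AllWords NonEmpty (I x)
I-nonEmpty [] = []
I-nonEmpty ((d , []) ∷ x) = I-nonEmpty x
I-nonEmpty ((d , s ∷ w) ∷ x) = _ ∷ I-nonEmpty x

J-nonEmpty : ∀ x → AllWords NonEmpty (J x)
J-nonEmpty [] = []
J-nonEmpty ((d , []) ∷ x) = J-nonEmpty x
J-nonEmpty ((d , s ∷ w) ∷ x) = _ ∷ J-nonEmpty x

J⊖-nonEmpty : ∀ x y → AllWords NonEmpty y → AllWords NonEmpty (J x ⊖ y)
J⊖-nonEmpty x y = AllWords-⊖ (J x) y (J-nonEmpty x)

I-positive : ∀ x → AllWords (Head ℤ.NonNegative) x → AllWords (Head ℤ.Positive) (I x)
I-positive [] [] = []
I-positive ((d , + n ∷ w) ∷ x) (_ ∷ ps) = _ ∷ I-positive x ps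

positive⇒nonNegative : ∀ x → AllWords (Head ℤ.Positive) x → AllWords (Head ℤ.NonNegative) x
positive⇒nonNegative [] [] = []
positive⇒nonNegative ((d , +[1+ n ] ∷ w) ∷ x) (_ ∷ ps) = _ ∷ positive⇒nonNegative x ps

module _ (t′ : Word) (g : Word → H) (h : ℤ → H) where
  open Heads t′ g h

  Z-nonEmpty : ∀ y → AllWords NonEmpty (Z y)
  Z-nonEmpty y = AllWords-prefix (+ 0) (g (y ∷ t′)) _

  heads-nonEmpty : ∀ x y → AllWords NonEmpty (heads x y)
  heads-nonEmpty (+ a) (+ b) = P-nonEmpty a b
    where
    P-nonEmpty : ∀ a b → AllWords NonEmpty (P a b)
    P-nonEmpty zero b = Z-nonEmpty (+ b)
    P-nonEmpty (suc m) zero = AllWords-prefix (+ 0) (h +[1+ m ]) _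
    P-nonEmpty (suc m) (suc n) = ++⁺ (I-nonEmpty (P (suc m) n)) (I-nonEmpty (P m (suc n)))
  heads-nonEmpty (+ a) -[1+ n ] = Q-nonEmpty a n
    where
    Q-nonEmpty : ∀ a n → AllWords NonEmpty (Q a n)
    Q-nonEmpty zero n = Z-nonEmpty -[1+ n ]
    Q-nonEmpty (suc m) zero = J⊖-nonEmpty (P (suc m) zero) (P m zero) (heads-nonEmpty (+ m) (+ 0))
    Q-nonEmpty (suc m) (suc n) = J⊖-nonEmpty (Q (suc m) n) (Q m n) (Q-nonEmpty m n)
  heads-nonEmpty -[1+ m ] y = Neg-nonEmpty m y
    where
    Neg-nonEmpty : ∀ m y → AllWords NonEmpty (Neg m y)
    Neg-nonEmpty zero y = J⊖-nonEmpty (Z y) (Z (ℤ.pred y)) (Z-nonEmpty (ℤ.pred y))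
    Neg-nonEmpty (suc m) y = J⊖-nonEmpty (Neg m y) (Neg m (ℤ.pred y)) (Neg-nonEmpty m (ℤ.pred y))

  P-nonNegative : ∀ a b → AllWords (Head ℤ.NonNegative) (P a b)
  P-positive : ∀ m n → AllWords (Head ℤ.Positive) (P (suc m) (suc n))

  P-nonNegative zero b = AllWords-prefix (+ 0) (g (+ b ∷ t′)) _
  P-nonNegative (suc m) zero = AllWords-prefix (+ 0) (h +[1+ m ]) _
  P-nonNegative (suc m) (suc n) = positive⇒nonNegative _ (P-positive m n)

  P-positive m n = ++⁺ (I-positive (P (suc m) n) (P-nonNegative (suc m) n))
                       (I-positive (P m (suc n)) (P-nonNegative m (suc n)))

shw-nonEmpty : ∀ s v u → AllWords NonEmpty (shw (s ∷ v) u)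
shw-nonEmpty s v [] = _ ∷ []
shw-nonEmpty s v (t ∷ u) = heads-nonEmpty u (shw v) (λ s′ → shw (s′ ∷ v) u) s t

shw-positive : ∀ m n v u → AllWords (Head ℤ.Positive) (shw (+[1+ m ] ∷ v) (+[1+ n ] ∷ u))
shw-positive m n v u = P-positive u (shw v) (λ s′ → shw (s′ ∷ v) u) m n

⧢-nonEmpty : ∀ x y → AllWords NonEmpty x → AllWords NonEmpty (x ⧢ y)
⧢-nonEmpty x y ne = AllWords-⧢ {Q = λ _ → ⊤} shw-ne x y ne (All.universal _ y)
  where
  shw-ne : ∀ v w → NonEmpty v → ⊤ → AllWords NonEmpty (shw v w)
  shw-ne (s ∷ v) w _ _ = shw-nonEmpty s v w

⧢-positive : ∀ x y → AllWords (Head ℤ.Positive) x → AllWords (Head ℤ.Positive) y →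
             AllWords (Head ℤ.Positive) (x ⧢ y)
⧢-positive = AllWords-⧢ shw-pos
  where
  shw-pos : ∀ v w → Head ℤ.Positive v → Head ℤ.Positive w → AllWords (Head ℤ.Positive) (shw v w)
  shw-pos (+[1+ m ] ∷ v) (+[1+ n ] ∷ w) _ _ = shw-positive m n v w

-- The defining recursions (i)–(v) as equations

shw-[] : ∀ v → shw v [] ≡ ⟦ v ⟧
shw-[] [] = refl
shw-[] (s ∷ v) = refl

rule-i : ∀ v u → shw (+ 0 ∷ v) u ≡ prefix (+ 0) (shw v u)
rule-i v [] = cong (prefix (+ 0)) (sym (shw-[] v))
rule-i v (+ n ∷ u) = refl
rule-i v (-[1+ n ] ∷ u) = refl

rule-ii : ∀ m v u → shw (+[1+ m ] ∷ v) (+ 0 ∷ u) ≡ prefix (+ 0) (shw (+[1+ m ] ∷ v) u)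
rule-ii m v [] = refl
rule-ii m v (t ∷ u) = refl

rule-iii : ∀ m n v u → shw (+[1+ m ] ∷ v) (+[1+ n ] ∷ u) ≡
           I (shw (+[1+ m ] ∷ v) (+ n ∷ u)) ⊕ I (shw (+ m ∷ v) (+[1+ n ] ∷ u))
rule-iii m n v u = refl

rule-iv : ∀ m t v u → .{{ℤ.NonPositive t}} →
          shw (+[1+ m ] ∷ v) (ℤ.pred t ∷ u) ≡ J (shw (+[1+ m ] ∷ v) (t ∷ u)) ⊖ shw (+ m ∷ v) (t ∷ u)
rule-iv m (+ 0) v u = refl
rule-iv m -[1+ n ] v u = refl

rule-v : ∀ s v t u → .{{ℤ.NonPositive s}} →
         shw (ℤ.pred s ∷ v) (t ∷ u) ≡ J (shw (s ∷ v) (t ∷ u)) ⊖ shw (s ∷ v) (ℤ.pred t ∷ u)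
rule-v (+ 0) v (+ 0) u = refl
rule-v (+ 0) v +[1+ n ] u = refl
rule-v (+ 0) v -[1+ n ] u = refl
rule-v -[1+ m ] v t u = refl

-- J is a derivation of ⧢

IᵀJᵀ-on-nonEmpty : ∀ F x → AllWords NonEmpty x → ⟨ Iᵀ (Jᵀ F) ∣ x ⟩ ≡ ⟨ F ∣ x ⟩
IᵀJᵀ-on-nonEmpty F = ⟨∣⟩-congOn λ { (s ∷ w) _ → cong (λ r → F (r ∷ w)) (ℤₚ.pred-suc s) }

JᵀIᵀ-on-nonEmpty : ∀ F x → AllWords NonEmpty x → ⟨ Jᵀ (Iᵀ F) ∣ x ⟩ ≡ ⟨ F ∣ x ⟩
JᵀIᵀ-on-nonEmpty F = ⟨∣⟩-congOn λ { (s ∷ w) _ → cong (λ r → F (r ∷ w)) (ℤₚ.suc-pred s) }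

leibniz-from-rule : ∀ F x y {z} → z ≡ J x ⊖ y → ⟨ Jᵀ F ∣ x ⟩ ≡ ⟨ F ∣ z ⟩ + ⟨ F ∣ y ⟩
leibniz-from-rule F x y refl =
  sym (trans (cong (_+ ⟨ F ∣ y ⟩) (trans (⟨∣⊖⟩ F (J x) y) (cong (_- ⟨ F ∣ y ⟩) (⟨∣J⟩ F x))))
             (solve 2 (λ a b → (a :- b) :+ b := a) refl ⟨ Jᵀ F ∣ x ⟩ ⟨ F ∣ y ⟩))

Δ-leibniz : ∀ F v u → ⟨ Jᵀ F ∣ shw v u ⟩ ≡ Jᵀ (λ v′ → Δ F v′ u) v + Jᵀ (Δ F v) u
Δ-leibniz F [] [] = trans (⟨∣⟦⟧⟩ (Jᵀ F) []) (sym (ℚₚ.+-identityˡ 0ℚ))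
Δ-leibniz F [] (t ∷ u) =
  trans (⟨∣⟦⟧⟩ (Jᵀ F) (t ∷ u)) (sym (trans (ℚₚ.+-identityˡ _) (⟨∣⟦⟧⟩ F (ℤ.pred t ∷ u))))
Δ-leibniz F (s ∷ v) [] =
  trans (⟨∣⟦⟧⟩ (Jᵀ F) (s ∷ v)) (sym (trans (ℚₚ.+-identityʳ _) (⟨∣⟦⟧⟩ F (ℤ.pred s ∷ v))))
Δ-leibniz F (+ 0 ∷ v) (t ∷ u) =
  leibniz-from-rule F (shw (+ 0 ∷ v) (t ∷ u)) (shw (+ 0 ∷ v) (ℤ.pred t ∷ u))
    (rule-v (+ 0) v t u)
Δ-leibniz F (-[1+ m ] ∷ v) (t ∷ u) =
  leibniz-from-rule F (shw (-[1+ m ] ∷ v) (t ∷ u)) (shw (-[1+ m ] ∷ v) (ℤ.pred t ∷ u))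
    (rule-v -[1+ m ] v t u)
Δ-leibniz F (+[1+ m ] ∷ v) (+ 0 ∷ u) =
  trans (leibniz-from-rule F (shw (+[1+ m ] ∷ v) (+ 0 ∷ u)) (shw (+ m ∷ v) (+ 0 ∷ u))
           (rule-iv m (+ 0) v u))
        (ℚₚ.+-comm _ (Δ F (+ m ∷ v) (+ 0 ∷ u)))
Δ-leibniz F (+[1+ m ] ∷ v) (-[1+ n ] ∷ u) =
  trans (leibniz-from-rule F (shw (+[1+ m ] ∷ v) (-[1+ n ] ∷ u)) (shw (+ m ∷ v) (-[1+ n ] ∷ u))
           (rule-iv m -[1+ n ] v u))
        (ℚₚ.+-comm _ (Δ F (+ m ∷ v) (-[1+ n ] ∷ u)))
Δ-leibniz F (+[1+ m ] ∷ v) (+[1+ n ] ∷ u) = begin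
    ⟨ Jᵀ F ∣ shw (+[1+ m ] ∷ v) (+[1+ n ] ∷ u) ⟩  ≡⟨ cong ⟨ Jᵀ F ∣_⟩ (rule-iii m n v u) ⟩
    ⟨ Jᵀ F ∣ I x ⊕ I y ⟩                         ≡⟨ ⟨∣⊕⟩ (Jᵀ F) (I x) (I y) ⟩
    ⟨ Jᵀ F ∣ I x ⟩ + ⟨ Jᵀ F ∣ I y ⟩               ≡⟨ cong₂ _+_ (⟨∣I⟩ (Jᵀ F) x) (⟨∣I⟩ (Jᵀ F) y) ⟩
    ⟨ Iᵀ (Jᵀ F) ∣ x ⟩ + ⟨ Iᵀ (Jᵀ F) ∣ y ⟩         ≡⟨ cong₂ _+_ (IᵀJᵀ-on-nonEmpty F x x-nonEmpty)
                                                                (IᵀJᵀ-on-nonEmpty F y y-nonEmpty) ⟩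
    ⟨ F ∣ x ⟩ + ⟨ F ∣ y ⟩                         ≡⟨ ℚₚ.+-comm ⟨ F ∣ x ⟩ ⟨ F ∣ y ⟩ ⟩
    ⟨ F ∣ y ⟩ + ⟨ F ∣ x ⟩                         ∎
  where
  open ≡-Reasoning
  x = shw (+[1+ m ] ∷ v) (+ n ∷ u)
  y = shw (+ m ∷ v) (+[1+ n ] ∷ u)
  x-nonEmpty = shw-nonEmpty +[1+ m ] v (+ n ∷ u)
  y-nonEmpty = shw-nonEmpty (+ m) v (+[1+ n ] ∷ u)

⟨∣Jᵀ⟩ : ∀ (G : Word → Word → ℚ) y v →
        ⟨ (λ u → Jᵀ (λ v′ → G v′ u) v) ∣ y ⟩ ≡ Jᵀ (λ v′ → ⟨ G v′ ∣ y ⟩) v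
⟨∣Jᵀ⟩ G y [] = ⟨0∣⟩ y
⟨∣Jᵀ⟩ G y (s ∷ v) = refl

J-leibniz : ∀ x y → J (x ⧢ y) ≈ (J x ⧢ y) ⊕ (x ⧢ J y)
J-leibniz x y = mk≈ λ F → begin
    ⟨ F ∣ J (x ⧢ y) ⟩
  ≡⟨ trans (⟨∣J⟩ F (x ⧢ y)) (⟨∣⧢⟩ (Jᵀ F) x y) ⟩
    ⟨ (λ v → ⟨ Δ (Jᵀ F) v ∣ y ⟩) ∣ x ⟩
  ≡⟨ ⟨∣⟩-cong (λ v → trans (⟨∣⟩-cong (Δ-leibniz F v) y) (⟨+∣⟩ _ _ y)) x ⟩
    ⟨ (λ v → ⟨ (λ u → Jᵀ (λ v′ → Δ F v′ u) v) ∣ y ⟩ + ⟨ Jᵀ (Δ F v) ∣ y ⟩) ∣ x ⟩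
  ≡⟨ ⟨∣⟩-cong (λ v → cong₂ _+_ (⟨∣Jᵀ⟩ (Δ F) y v) (sym (⟨∣J⟩ (Δ F v) y))) x ⟩
    ⟨ (λ v → Jᵀ (λ v′ → ⟨ Δ F v′ ∣ y ⟩) v + ⟨ Δ F v ∣ J y ⟩) ∣ x ⟩
  ≡⟨ ⟨+∣⟩ _ _ x ⟩
    ⟨ Jᵀ (λ v′ → ⟨ Δ F v′ ∣ y ⟩) ∣ x ⟩ + ⟨ (λ v → ⟨ Δ F v ∣ J y ⟩) ∣ x ⟩
  ≡⟨ sym (cong₂ _+_ (trans (⟨∣⧢⟩ F (J x) y) (⟨∣J⟩ _ x)) (⟨∣⧢⟩ F x (J y))) ⟩
    ⟨ F ∣ J x ⧢ y ⟩ + ⟨ F ∣ x ⧢ J y ⟩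
  ≡⟨ sym (⟨∣⊕⟩ F (J x ⧢ y) (x ⧢ J y)) ⟩
    ⟨ F ∣ (J x ⧢ y) ⊕ (x ⧢ J y) ⟩
  ∎
  where open ≡-Reasoning

I∘J-on-nonEmpty : ∀ x → AllWords NonEmpty x → I (J x) ≈ x
I∘J-on-nonEmpty x ne = mk≈ λ F →
  trans (⟨∣I⟩ F (J x)) (trans (⟨∣J⟩ (Iᵀ F) x) (JᵀIᵀ-on-nonEmpty F x ne))

𝟏 : H
𝟏 = ⟦ [] ⟧

⧢-identityˡ : ∀ y → 𝟏 ⧢ y ≈ y
⧢-identityˡ y = mk≈ λ F →
  trans (⟨∣⧢⟩ F 𝟏 y) (trans (⟨∣⟦⟧⟩ (λ v → ⟨ Δ F v ∣ y ⟩) []) (⟨∣⟩-cong (⟨∣⟦⟧⟩ F) y))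

⧢-identityʳ : ∀ x → x ⧢ 𝟏 ≈ x
⧢-identityʳ x = mk≈ λ F → trans (⟨∣⧢⟩ F x 𝟏)
  (⟨∣⟩-cong (λ v → trans (⟨∣⟦⟧⟩ (Δ F v) []) (trans (cong ⟨ F ∣_⟩ (shw-[] v)) (⟨∣⟦⟧⟩ F v))) x)

Δ-prefix₀ˡ : ∀ F v u → Δ F (+ 0 ∷ v) u ≡ Δ (F ∘ (+ 0 ∷_)) v u
Δ-prefix₀ˡ F v u = trans (cong ⟨ F ∣_⟩ (rule-i v u)) (⟨∣prefix⟩ F (+ 0) (shw v u))

Δ-prefix₀ʳ : ∀ F m v u → Δ F (+[1+ m ] ∷ v) (+ 0 ∷ u) ≡ Δ (F ∘ (+ 0 ∷_)) (+[1+ m ] ∷ v) u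
Δ-prefix₀ʳ F m v u =
  trans (cong ⟨ F ∣_⟩ (rule-ii m v u)) (⟨∣prefix⟩ F (+ 0) (shw (+[1+ m ] ∷ v) u))

prefix₀-⧢ : ∀ x y → prefix (+ 0) x ⧢ y ≈ prefix (+ 0) (x ⧢ y)
prefix₀-⧢ x y = mk≈ λ F → begin
    ⟨ F ∣ prefix (+ 0) x ⧢ y ⟩
  ≡⟨ trans (⟨∣⧢⟩ F (prefix (+ 0) x) y) (⟨∣prefix⟩ _ (+ 0) x) ⟩
    ⟨ (λ v → ⟨ Δ F (+ 0 ∷ v) ∣ y ⟩) ∣ x ⟩
  ≡⟨ ⟨∣⟩-cong (λ v → ⟨∣⟩-cong (Δ-prefix₀ˡ F v) y) x ⟩
    ⟨ (λ v → ⟨ Δ (F ∘ (+ 0 ∷_)) v ∣ y ⟩) ∣ x ⟩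
  ≡⟨ sym (trans (⟨∣prefix⟩ F (+ 0) (x ⧢ y)) (⟨∣⧢⟩ (F ∘ (+ 0 ∷_)) x y)) ⟩
    ⟨ F ∣ prefix (+ 0) (x ⧢ y) ⟩
  ∎
  where open ≡-Reasoning

⧢-prefix₀ : ∀ x y → AllWords (Head ℤ.Positive) x → x ⧢ prefix (+ 0) y ≈ prefix (+ 0) (x ⧢ y)
⧢-prefix₀ x y pos = mk≈ λ F → begin
    ⟨ F ∣ x ⧢ prefix (+ 0) y ⟩
  ≡⟨ trans (⟨∣⧢⟩ F x (prefix (+ 0) y)) (⟨∣⟩-cong (λ v → ⟨∣prefix⟩ (Δ F v) (+ 0) y) x) ⟩
    ⟨ (λ v → ⟨ Δ F v ∘ (+ 0 ∷_) ∣ y ⟩) ∣ x ⟩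
  ≡⟨ ⟨∣⟩-congOn (shift F) x pos ⟩
    ⟨ (λ v → ⟨ Δ (F ∘ (+ 0 ∷_)) v ∣ y ⟩) ∣ x ⟩
  ≡⟨ sym (trans (⟨∣prefix⟩ F (+ 0) (x ⧢ y)) (⟨∣⧢⟩ (F ∘ (+ 0 ∷_)) x y)) ⟩
    ⟨ F ∣ prefix (+ 0) (x ⧢ y) ⟩
  ∎
  where
  open ≡-Reasoning
  shift : ∀ F v → Head ℤ.Positive v → ⟨ Δ F v ∘ (+ 0 ∷_) ∣ y ⟩ ≡ ⟨ Δ (F ∘ (+ 0 ∷_)) v ∣ y ⟩
  shift F (+[1+ m ] ∷ v) _ = ⟨∣⟩-cong (Δ-prefix₀ʳ F m v) y

Assoc : H → H → H → Set
Assoc x y z = (x ⧢ y) ⧢ z ≈ x ⧢ (y ⧢ z)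

assoc-𝟏ˡ : ∀ y z → Assoc 𝟏 y z
assoc-𝟏ˡ y z = ≈-trans (⧢-congʳ z (⧢-identityˡ y)) (≈-sym (⧢-identityˡ (y ⧢ z)))

assoc-𝟏ᵐ : ∀ x z → Assoc x 𝟏 z
assoc-𝟏ᵐ x z = ≈-trans (⧢-congʳ z (⧢-identityʳ x)) (≈-sym (⧢-congˡ x (⧢-identityˡ z)))

assoc-𝟏ʳ : ∀ x y → Assoc x y 𝟏
assoc-𝟏ʳ x y = ≈-trans (⧢-identityʳ (x ⧢ y)) (≈-sym (⧢-congˡ x (⧢-identityʳ y)))

module _ {x y z : H} where
  open ≈-Reasoning

  assoc-prefix₀ˡ : Assoc x y z → Assoc (prefix (+ 0) x) y z
  assoc-prefix₀ˡ a = begin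
    (prefix (+ 0) x ⧢ y) ⧢ z    ≈⟨ ⧢-congʳ z (prefix₀-⧢ x y) ⟩
    prefix (+ 0) (x ⧢ y) ⧢ z    ≈⟨ prefix₀-⧢ (x ⧢ y) z ⟩
    prefix (+ 0) ((x ⧢ y) ⧢ z)  ≈⟨ prefix-cong (+ 0) a ⟩
    prefix (+ 0) (x ⧢ (y ⧢ z))  ≈⟨ prefix₀-⧢ x (y ⧢ z) ⟨
    prefix (+ 0) x ⧢ (y ⧢ z)    ∎

  assoc-prefix₀ᵐ : AllWords (Head ℤ.Positive) x → Assoc x y z → Assoc x (prefix (+ 0) y) z
  assoc-prefix₀ᵐ pos a = begin
    (x ⧢ prefix (+ 0) y) ⧢ z    ≈⟨ ⧢-congʳ z (⧢-prefix₀ x y pos) ⟩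
    prefix (+ 0) (x ⧢ y) ⧢ z    ≈⟨ prefix₀-⧢ (x ⧢ y) z ⟩
    prefix (+ 0) ((x ⧢ y) ⧢ z)  ≈⟨ prefix-cong (+ 0) a ⟩
    prefix (+ 0) (x ⧢ (y ⧢ z))  ≈⟨ ⧢-prefix₀ x (y ⧢ z) pos ⟨
    x ⧢ prefix (+ 0) (y ⧢ z)    ≈⟨ ⧢-congˡ x (prefix₀-⧢ y z) ⟨
    x ⧢ (prefix (+ 0) y ⧢ z)    ∎

  assoc-prefix₀ʳ : AllWords (Head ℤ.Positive) x → AllWords (Head ℤ.Positive) y →
                   Assoc x y z → Assoc x y (prefix (+ 0) z)
  assoc-prefix₀ʳ pos-x pos-y a = begin
    (x ⧢ y) ⧢ prefix (+ 0) z    ≈⟨ ⧢-prefix₀ (x ⧢ y) z (⧢-positive x y pos-x pos-y) ⟩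
    prefix (+ 0) ((x ⧢ y) ⧢ z)  ≈⟨ prefix-cong (+ 0) a ⟩
    prefix (+ 0) (x ⧢ (y ⧢ z))  ≈⟨ ⧢-prefix₀ x (y ⧢ z) pos-x ⟨
    x ⧢ prefix (+ 0) (y ⧢ z)    ≈⟨ ⧢-congˡ x (⧢-prefix₀ y z pos-y) ⟨
    x ⧢ (y ⧢ prefix (+ 0) z)    ∎

  J-leibniz₃ˡ : J ((x ⧢ y) ⧢ z) ≈ (((J x ⧢ y) ⧢ z) ⊕ ((x ⧢ J y) ⧢ z)) ⊕ ((x ⧢ y) ⧢ J z)
  J-leibniz₃ˡ = begin
    J ((x ⧢ y) ⧢ z)
      ≈⟨ J-leibniz (x ⧢ y) z ⟩
    (J (x ⧢ y) ⧢ z) ⊕ ((x ⧢ y) ⧢ J z)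
      ≈⟨ ⊕-congʳ ((x ⧢ y) ⧢ J z) (⧢-congʳ z (J-leibniz x y)) ⟩
    (((J x ⧢ y) ⊕ (x ⧢ J y)) ⧢ z) ⊕ ((x ⧢ y) ⧢ J z)
      ≈⟨ ⊕-congʳ ((x ⧢ y) ⧢ J z) (⧢-distribʳ-⊕ (J x ⧢ y) (x ⧢ J y) z) ⟩
    (((J x ⧢ y) ⧢ z) ⊕ ((x ⧢ J y) ⧢ z)) ⊕ ((x ⧢ y) ⧢ J z)
      ∎

  J-leibniz₃ʳ : J (x ⧢ (y ⧢ z)) ≈ ((J x ⧢ (y ⧢ z)) ⊕ (x ⧢ (J y ⧢ z))) ⊕ (x ⧢ (y ⧢ J z))
  J-leibniz₃ʳ = begin
    J (x ⧢ (y ⧢ z))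
      ≈⟨ J-leibniz x (y ⧢ z) ⟩
    (J x ⧢ (y ⧢ z)) ⊕ (x ⧢ J (y ⧢ z))
      ≈⟨ ⊕-congˡ (J x ⧢ (y ⧢ z)) (⧢-congˡ x (J-leibniz y z)) ⟩
    (J x ⧢ (y ⧢ z)) ⊕ (x ⧢ ((J y ⧢ z) ⊕ (y ⧢ J z)))
      ≈⟨ ⊕-congˡ (J x ⧢ (y ⧢ z)) (⧢-distribˡ-⊕ x (J y ⧢ z) (y ⧢ J z)) ⟩
    (J x ⧢ (y ⧢ z)) ⊕ ((x ⧢ (J y ⧢ z)) ⊕ (x ⧢ (y ⧢ J z)))
      ≈⟨ ⊕-assoc (J x ⧢ (y ⧢ z)) (x ⧢ (J y ⧢ z)) (x ⧢ (y ⧢ J z)) ⟨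
    ((J x ⧢ (y ⧢ z)) ⊕ (x ⧢ (J y ⧢ z))) ⊕ (x ⧢ (y ⧢ J z))
      ∎

  assoc-leibniz : Assoc x y z →
    (((J x ⧢ y) ⧢ z) ⊕ ((x ⧢ J y) ⧢ z)) ⊕ ((x ⧢ y) ⧢ J z) ≈
    ((J x ⧢ (y ⧢ z)) ⊕ (x ⧢ (J y ⧢ z))) ⊕ (x ⧢ (y ⧢ J z))
  assoc-leibniz a = ≈-trans (≈-sym J-leibniz₃ˡ) (≈-trans (J-cong a) J-leibniz₃ʳ)

  assoc-raise : AllWords NonEmpty x →
                Assoc (J x) y z → Assoc x (J y) z → Assoc x y (J z) → Assoc x y z
  assoc-raise ne p q r = begin
    (x ⧢ y) ⧢ z
      ≈⟨ I∘J-on-nonEmpty ((x ⧢ y) ⧢ z) (⧢-nonEmpty (x ⧢ y) z (⧢-nonEmpty x y ne)) ⟨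
    I (J ((x ⧢ y) ⧢ z))
      ≈⟨ I-cong (≈-trans J-leibniz₃ˡ (≈-trans (⊕-cong (⊕-cong p q) r) (≈-sym J-leibniz₃ʳ))) ⟩
    I (J (x ⧢ (y ⧢ z)))
      ≈⟨ I∘J-on-nonEmpty (x ⧢ (y ⧢ z)) (⧢-nonEmpty x (y ⧢ z) ne) ⟩
    x ⧢ (y ⧢ z)
      ∎

  assoc-lower₁ : Assoc x y z → Assoc x (J y) z → Assoc x y (J z) → Assoc (J x) y z
  assoc-lower₁ a q r = ⊕-cancelʳ (⊕-cancelʳ (assoc-leibniz a) r) q

  assoc-lower₂ : Assoc x y z → Assoc (J x) y z → Assoc x y (J z) → Assoc x (J y) z
  assoc-lower₂ a p r = ⊕-cancelˡ (⊕-cancelʳ (assoc-leibniz a) r) p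

  assoc-lower₃ : Assoc x y z → Assoc (J x) y z → Assoc x (J y) z → Assoc x y (J z)
  assoc-lower₃ a p q = ⊕-cancelˡ (assoc-leibniz a) (⊕-cong p q)

assoc-cons : ∀ a b c →
  (∀ t u → Assoc ⟦ a ⟧ ⟦ t ∷ b ⟧ ⟦ u ∷ c ⟧) →
  (∀ s u → Assoc ⟦ s ∷ a ⟧ ⟦ b ⟧ ⟦ u ∷ c ⟧) →
  (∀ s t → Assoc ⟦ s ∷ a ⟧ ⟦ t ∷ b ⟧ ⟦ c ⟧) →
  ∀ s t u → Assoc ⟦ s ∷ a ⟧ ⟦ t ∷ b ⟧ ⟦ u ∷ c ⟧
assoc-cons a b c tail-a tail-b tail-c =
  cube-induction (λ s t u → Assoc (x s) (y t) (z u))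
    (λ t u → assoc-prefix₀ˡ {⟦ a ⟧} {y t} {z u} (tail-a t u))
    (λ m u → assoc-prefix₀ᵐ {x +[1+ m ]} {⟦ b ⟧} {z u} (_ ∷ []) (tail-b +[1+ m ] u))
    (λ m n → assoc-prefix₀ʳ {x +[1+ m ]} {y +[1+ n ]} {⟦ c ⟧} (_ ∷ []) (_ ∷ [])
               (tail-c +[1+ m ] +[1+ n ]))
    (λ s t u → assoc-raise {x s} {y t} {z u} (_ ∷ []))
    (λ s t u → assoc-lower₁ {x s} {y t} {z u})
    (λ s t u → assoc-lower₂ {x s} {y t} {z u})
    (λ s t u → assoc-lower₃ {x s} {y t} {z u})
  where
  x y z : ℤ → H
  x s = ⟦ s ∷ a ⟧
  y t = ⟦ t ∷ b ⟧
  z u = ⟦ u ∷ c ⟧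

assoc-word : ∀ a b c → Assoc ⟦ a ⟧ ⟦ b ⟧ ⟦ c ⟧
assoc-word [] b c = assoc-𝟏ˡ ⟦ b ⟧ ⟦ c ⟧
assoc-word (s ∷ a) b c = middle b s c
  where
  middle : ∀ b s c → Assoc ⟦ s ∷ a ⟧ ⟦ b ⟧ ⟦ c ⟧
  middle [] s c = assoc-𝟏ᵐ ⟦ s ∷ a ⟧ ⟦ c ⟧
  middle (t ∷ b) s c = last c s t
    where
    last : ∀ c s t → Assoc ⟦ s ∷ a ⟧ ⟦ t ∷ b ⟧ ⟦ c ⟧
    last [] s t = assoc-𝟏ʳ ⟦ s ∷ a ⟧ ⟦ t ∷ b ⟧
    last (u ∷ c) s t = assoc-cons a b c
      (λ t u → assoc-word a (t ∷ b) (u ∷ c))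
      (λ s u → middle b s (u ∷ c))
      (λ s t → last c s t)
      s t u

record Linear (f : H → H) : Set where
  constructor mk-linear
  field expand : ∀ F x → ⟨ F ∣ f x ⟩ ≡ ⟨ (λ v → ⟨ F ∣ f ⟦ v ⟧ ⟩) ∣ x ⟩
open Linear

∘-linear : ∀ {f g} → Linear f → Linear g → Linear (f ∘ g)
∘-linear {f} {g} lin-f lin-g = mk-linear λ F x → begin
    ⟨ F ∣ f (g x) ⟩
  ≡⟨ expand lin-f F (g x) ⟩
    ⟨ (λ u → ⟨ F ∣ f ⟦ u ⟧ ⟩) ∣ g x ⟩
  ≡⟨ expand lin-g _ x ⟩
    ⟨ (λ v → ⟨ (λ u → ⟨ F ∣ f ⟦ u ⟧ ⟩) ∣ g ⟦ v ⟧ ⟩) ∣ x ⟩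
  ≡⟨ ⟨∣⟩-cong (λ v → sym (expand lin-f F (g ⟦ v ⟧))) x ⟩
    ⟨ (λ v → ⟨ F ∣ f (g ⟦ v ⟧) ⟩) ∣ x ⟩
  ∎
  where open ≡-Reasoning

linear-ext : ∀ {f g} → Linear f → Linear g → (∀ v → f ⟦ v ⟧ ≈ g ⟦ v ⟧) → ∀ x → f x ≈ g x
linear-ext lin-f lin-g eq x = mk≈ λ F →
  trans (expand lin-f F x) (trans (⟨∣⟩-cong (λ v → test (eq v) F) x) (sym (expand lin-g F x)))

⧢-linearˡ : ∀ y → Linear (_⧢ y)
⧢-linearˡ y = mk-linear λ F x → trans (⟨∣⧢⟩ F x y)
  (⟨∣⟩-cong (λ v → sym (trans (⟨∣⧢⟩ F ⟦ v ⟧ y) (⟨∣⟦⟧⟩ (λ v′ → ⟨ Δ F v′ ∣ y ⟩) v))) x)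

⧢-linearʳ : ∀ x → Linear (x ⧢_)
⧢-linearʳ x = mk-linear λ F y → begin
    ⟨ F ∣ x ⧢ y ⟩
  ≡⟨ ⟨∣⧢⟩ F x y ⟩
    ⟨ (λ v → ⟨ Δ F v ∣ y ⟩) ∣ x ⟩
  ≡⟨ ⟨∣⟩-swap (Δ F) x y ⟩
    ⟨ (λ w → ⟨ (λ v → Δ F v w) ∣ x ⟩) ∣ y ⟩
  ≡⟨ ⟨∣⟩-cong (λ w → sym (trans (⟨∣⧢⟩ F x ⟦ w ⟧) (⟨∣⟩-cong (λ v → ⟨∣⟦⟧⟩ (Δ F v) w) x))) y ⟩
    ⟨ (λ w → ⟨ F ∣ x ⧢ ⟦ w ⟧ ⟩) ∣ y ⟩
  ∎
  where open ≡-Reasoning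

⧢-assoc : ∀ x y z → Assoc x y z
⧢-assoc x y z =
  linear-ext (∘-linear (⧢-linearˡ z) (⧢-linearˡ y)) (⧢-linearˡ (y ⧢ z)) (λ u → on-basisˡ u y z) x
  where
  on-basis : ∀ u v z → Assoc ⟦ u ⟧ ⟦ v ⟧ z
  on-basis u v = linear-ext (⧢-linearʳ (⟦ u ⟧ ⧢ ⟦ v ⟧))
                            (∘-linear (⧢-linearʳ ⟦ u ⟧) (⧢-linearʳ ⟦ v ⟧)) (assoc-word u v)

  on-basisˡ : ∀ u y z → Assoc ⟦ u ⟧ y z
  on-basisˡ u y z = linear-ext (∘-linear (⧢-linearˡ z) (⧢-linearʳ ⟦ u ⟧))
                               (∘-linear (⧢-linearʳ ⟦ u ⟧) (⧢-linearˡ z)) (λ v → on-basis u v z) y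

δ : Word → H*
δ w v with ≡-dec ℤ._≟_ v w
... | yes _ = 1ℚ
... | no _ = 0ℚ

coeff-⟨δ∣⟩ : ∀ x w → coeff x w ≡ ⟨ δ w ∣ x ⟩
coeff-⟨δ∣⟩ [] w = refl
coeff-⟨δ∣⟩ ((c , v) ∷ x) w with ≡-dec ℤ._≟_ v w
... | yes _ = cong₂ _+_ (sym (ℚₚ.*-identityʳ c)) (coeff-⟨δ∣⟩ x w)
... | no _ = trans (coeff-⟨δ∣⟩ x w) (sym (drop-zero-term c _))

≈⇒coeff-≡ : ∀ {x y} → x ≈ y → ∀ w → coeff x w ≡ coeff y w
≈⇒coeff-≡ {x} {y} p w =
  trans (coeff-⟨δ∣⟩ x w) (trans (test p (δ w)) (sym (coeff-⟨δ∣⟩ y w)))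

proposition2p14 : (a b c : H) (w : Word) → coeff ((a ⧢ b) ⧢ c) w ≡ coeff (a ⧢ (b ⧢ c)) w
proposition2p14 a b c = ≈⇒coeff-≡ (⧢-assoc a b c)
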